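{- Let $a$ be a rational number with $v_3(a)=0$, and let $\mathcal{R}_a=\{(0,1/2),(0,-1/2),(a,1/2),(a,-1/2)\}$. Suppose $(x,z/2)\in\mathbb{R}^2$ has rational Euclidean distance to each of the four points of $\mathcal{R}_a$ (so in particular $x,z\in\mathbb{Q}$). Then $v_3(x)<0$ or $v_3(z)<0$.
   Context: For a prime $p$ and a nonzero rational $t=p^k r/s$ with $r,s$ integers coprime to $p$, $v_p(t)=k$; and $v_p(0)=\infty$. -}

module Defs where

open import Data.Nat as ℕ using (ℕ; suc; NonZero)
open import Data.Nat.Properties using (m*n≢0; m^n≢0)
open import Data.Nat.Divisibility using (_∣_)
open import Data.Integer as ℤ using (ℤ; +_; -[1+_]; ∣_∣)
open import Data.Rational using (ℚ; _/_; _+_; _-_; _*_; _≤_; 0ℚ; ½)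
open import Data.Product using (Σ; ∃-syntax; _×_)
open import Relation.Nullary using (¬_)
open import Relation.Binary.PropositionalEquality using (_≡_)

scaled : (p : ℕ) → (k : ℤ) → (r : ℤ) → (s : ℕ) → .{{NonZero p}} → .{{NonZero s}} → ℚ
scaled p (+ n)     r s = (ℤ.+ (p ℕ.^ n) ℤ.* r) / s
scaled p -[1+ n ]  r s = r / (p ℕ.^ suc n ℕ.* s)
  where instance
          nz : NonZero (p ℕ.^ suc n ℕ.* s)
          nz = m*n≢0 _ _ {{m^n≢0 p (suc n)}}

-- HasVal p t k  :⇔  t ≠ 0 and v_p(t) = k, i.e. t = p^k r/s with r,s integers coprime to p
-- (p prime; coprime to p is "not divisible by p"; r not divisible by p forces t ≠ 0).
HasVal : (p : ℕ) → .{{NonZero p}} → ℚ → ℤ → Set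
HasVal p {{nzp}} t k = Σ ℤ λ r → Σ ℕ λ s → Σ (NonZero s) λ nz →
  (¬ (p ∣ ∣ r ∣)) × (¬ (p ∣ s)) × (t ≡ scaled p k r s {{nzp}} {{nz}})

-- v_p(t) < 0   (false for t = 0, since v_p(0) = ∞)
ValNeg : (p : ℕ) → .{{NonZero p}} → ℚ → Set
ValNeg p t = ∃[ k ] (k ℤ.< + 0 × HasVal p t k)

RatDist : ℚ → ℚ → ℚ → ℚ → Set
RatDist x₁ y₁ x₂ y₂ = ∃[ d ] (0ℚ ≤ d × d * d ≡ (x₁ - x₂) * (x₁ - x₂) + (y₁ - y₂) * (y₁ - y₂))

{-# OPTIONS --safe #-}
-- Suppose x and z are 3-integral.  Reducing into ℤ₃, the point P = (x, z/2)
-- and the four corners acquire residues; the corners become (0,2), (0,1),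
-- (A,2), (A,1) with A ≢ 0, since ½ ≡ 2 and -½ ≡ 1.  A rational distance d from
-- P to a corner gives d² ≡ Δx² + Δy² mod 3; nonzero squares are 1 mod 3 and 2
-- is not a square, so P agrees with every corner in at least one coordinate.
-- No point does that for all four corners of a non-degenerate rectangle.
module Submission where

open import Defs
open import Data.Integer using (+_)
open import Data.Rational using (ℚ; _*_; ½; -½; 0ℚ)
open import Data.Sum using (_⊎_)
open import Data.Product using (_×_)

open import Function using (_∘_)
open import Data.Empty using (⊥; ⊥-elim; ⊥-elim-irr)
open import Data.Sum using (inj₁; inj₂)
open import Data.Product using (_,_; proj₁; proj₂; ∃; ∃₂)
open import Induction.WellFounded using (Acc; acc)
open import Relation.Nullary using (¬_; Dec; yes; no)
open import Relation.Nullary.Decidable using (map′; from-yes; ¬?; _×-dec_; _→-dec_)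
open import Relation.Binary.PropositionalEquality
  using (_≡_; _≢_; refl; sym; trans; cong; cong₂; subst; ≢-sym; module ≡-Reasoning)
open import Data.Nat as ℕ using (ℕ; zero; suc; NonZero; _^_)
import Data.Nat.Properties as ℕ
open import Data.Nat.Divisibility using (_∣_; divides; _∣?_; _∣0)
open import Data.Nat.Induction using (<-wellFounded)
open import Data.Integer as ℤ using (ℤ; -[1+_]; ∣_∣; _⊖_; _◃_; sign)
import Data.Integer.Properties as ℤ
open import Data.Sign as Sign using (Sign)
open import Data.Rational as ℚ using (mkℚ; ↥_; ↧ₙ_; toℚᵘ)
import Data.Rational.Properties as ℚ
open import Data.Rational.Unnormalised as ℚᵘ using (ℚᵘ; mkℚᵘ; *≡*; _≃_)
import Data.Rational.Unnormalised.Properties as ℚᵘ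

open ≡-Reasoning

data ℤ₃ : Set where
  0₃ 1₃ 2₃ : ℤ₃

infix  4 _≟₃_ _≢₃?_
infixl 6 _+₃_ _-₃_
infixl 7 _*₃_
infix  8 -₃_

suc₃ : ℤ₃ → ℤ₃
suc₃ 0₃ = 1₃
suc₃ 1₃ = 2₃
suc₃ 2₃ = 0₃

-₃_ : ℤ₃ → ℤ₃
-₃ 0₃ = 0₃
-₃ 1₃ = 2₃
-₃ 2₃ = 1₃

_+₃_ : ℤ₃ → ℤ₃ → ℤ₃
0₃ +₃ b = b
1₃ +₃ b = suc₃ b
2₃ +₃ b = suc₃ (suc₃ b)

_-₃_ : ℤ₃ → ℤ₃ → ℤ₃
a -₃ b = a +₃ -₃ b

_*₃_ : ℤ₃ → ℤ₃ → ℤ₃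
0₃ *₃ b = 0₃
1₃ *₃ b = b
2₃ *₃ b = -₃ b

_≟₃_ : (a b : ℤ₃) → Dec (a ≡ b)
0₃ ≟₃ 0₃ = yes refl
0₃ ≟₃ 1₃ = no λ ()
0₃ ≟₃ 2₃ = no λ ()
1₃ ≟₃ 0₃ = no λ ()
1₃ ≟₃ 1₃ = yes refl
1₃ ≟₃ 2₃ = no λ ()
2₃ ≟₃ 0₃ = no λ ()
2₃ ≟₃ 1₃ = no λ ()
2₃ ≟₃ 2₃ = yes refl

all₃? : {P : ℤ₃ → Set} → (∀ a → Dec (P a)) → Dec (∀ a → P a)
all₃? P? = map′ (λ { (p₀ , p₁ , p₂) → λ { 0₃ → p₀ ; 1₃ → p₁ ; 2₃ → p₂ } })
                (λ p → p 0₃ , p 1₃ , p 2₃)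
                (P? 0₃ ×-dec P? 1₃ ×-dec P? 2₃)

_≢₃?_ : (a b : ℤ₃) → Dec (a ≢ b)
a ≢₃? b = ¬? (a ≟₃ b)

suc₃-+₃ : ∀ a b → suc₃ a +₃ b ≡ suc₃ (a +₃ b)
suc₃-+₃ = from-yes (all₃? λ a → all₃? λ b → suc₃ a +₃ b ≟₃ suc₃ (a +₃ b))

suc₃-*₃ : ∀ a b → suc₃ a *₃ b ≡ b +₃ a *₃ b
suc₃-*₃ = from-yes (all₃? λ a → all₃? λ b → suc₃ a *₃ b ≟₃ b +₃ a *₃ b)

suc₃-₃suc₃ : ∀ a b → suc₃ a -₃ suc₃ b ≡ a -₃ b
suc₃-₃suc₃ = from-yes (all₃? λ a → all₃? λ b → suc₃ a -₃ suc₃ b ≟₃ a -₃ b)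

+₃-identityʳ : ∀ a → a +₃ 0₃ ≡ a
+₃-identityʳ = from-yes (all₃? λ a → a +₃ 0₃ ≟₃ a)

+₃-comm : ∀ a b → a +₃ b ≡ b +₃ a
+₃-comm = from-yes (all₃? λ a → all₃? λ b → a +₃ b ≟₃ b +₃ a)

-₃-involutive : ∀ a → -₃ -₃ a ≡ a
-₃-involutive = from-yes (all₃? λ a → -₃ -₃ a ≟₃ a)

-₃‿distrib-+₃ : ∀ a b → -₃ (a +₃ b) ≡ -₃ a +₃ -₃ b
-₃‿distrib-+₃ = from-yes (all₃? λ a → all₃? λ b → -₃ (a +₃ b) ≟₃ -₃ a +₃ -₃ b)

-₃‿distribˡ-*₃ : ∀ a b → -₃ (a *₃ b) ≡ -₃ a *₃ b
-₃‿distribˡ-*₃ = from-yes (all₃? λ a → all₃? λ b → -₃ (a *₃ b) ≟₃ -₃ a *₃ b)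

-₃‿distribʳ-*₃ : ∀ a b → -₃ (a *₃ b) ≡ a *₃ -₃ b
-₃‿distribʳ-*₃ = from-yes (all₃? λ a → all₃? λ b → -₃ (a *₃ b) ≟₃ a *₃ -₃ b)

-₃*₃-₃ : ∀ a b → a *₃ b ≡ -₃ a *₃ -₃ b
-₃*₃-₃ = from-yes (all₃? λ a → all₃? λ b → a *₃ b ≟₃ -₃ a *₃ -₃ b)

*₃-nonzero : ∀ a b → a ≢ 0₃ → b ≢ 0₃ → a *₃ b ≢ 0₃
*₃-nonzero = from-yes (all₃? λ a → all₃? λ b →
  a ≢₃? 0₃ →-dec b ≢₃? 0₃ →-dec a *₃ b ≢₃? 0₃)

-- The units of ℤ₃ are ±1, each its own inverse: n / d ≡ n * d.
unit-self-inverse : ∀ n d → d ≢ 0₃ → n ≡ (n *₃ d) *₃ d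
unit-self-inverse = from-yes (all₃? λ n → all₃? λ d →
  d ≢₃? 0₃ →-dec n ≟₃ (n *₃ d) *₃ d)

fraction-+₃ : ∀ r a s c → (r *₃ a) *₃ c +₃ (s *₃ c) *₃ a ≡ (r +₃ s) *₃ (a *₃ c)
fraction-+₃ = from-yes (all₃? λ r → all₃? λ a → all₃? λ s → all₃? λ c →
  (r *₃ a) *₃ c +₃ (s *₃ c) *₃ a ≟₃ (r +₃ s) *₃ (a *₃ c))

fraction-*₃ : ∀ r a s c → (r *₃ a) *₃ (s *₃ c) ≡ (r *₃ s) *₃ (a *₃ c)
fraction-*₃ = from-yes (all₃? λ r → all₃? λ a → all₃? λ s → all₃? λ c →
  (r *₃ a) *₃ (s *₃ c) ≟₃ (r *₃ s) *₃ (a *₃ c))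

cross-cancel : ∀ r a b c → a ≢ 0₃ → ¬ (b ≡ 0₃ × c ≡ 0₃) →
  (r *₃ a) *₃ c ≡ b *₃ a → c ≢ 0₃ × b ≡ r *₃ c
cross-cancel = from-yes (all₃? λ r → all₃? λ a → all₃? λ b → all₃? λ c →
  a ≢₃? 0₃ →-dec ¬? (b ≟₃ 0₃ ×-dec c ≟₃ 0₃) →-dec
  (r *₃ a) *₃ c ≟₃ b *₃ a →-dec c ≢₃? 0₃ ×-dec b ≟₃ r *₃ c)

cross-square : ∀ r e n d → e ≢ 0₃ → ¬ (n ≡ 0₃ × d ≡ 0₃) →
  (r *₃ e) *₃ (d *₃ d) ≡ (n *₃ n) *₃ e → r ≡ (n *₃ d) *₃ (n *₃ d)
cross-square = from-yes (all₃? λ r → all₃? λ e → all₃? λ n → all₃? λ d →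
  e ≢₃? 0₃ →-dec ¬? (n ≟₃ 0₃ ×-dec d ≟₃ 0₃) →-dec
  (r *₃ e) *₃ (d *₃ d) ≟₃ (n *₃ n) *₃ e →-dec r ≟₃ (n *₃ d) *₃ (n *₃ d))

2-nonsquare : ∀ s → s *₃ s ≢ 2₃
2-nonsquare = from-yes (all₃? λ s → s *₃ s ≢₃? 2₃)

nonzero-squares-sum≡2 : ∀ a b c d → a ≢ b → c ≢ d →
  (a -₃ b) *₃ (a -₃ b) +₃ (c -₃ d) *₃ (c -₃ d) ≡ 2₃
nonzero-squares-sum≡2 = from-yes (all₃? λ a → all₃? λ b → all₃? λ c → all₃? λ d →
  a ≢₃? b →-dec c ≢₃? d →-dec (a -₃ b) *₃ (a -₃ b) +₃ (c -₃ d) *₃ (c -₃ d) ≟₃ 2₃)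

fromℕ : ℕ → ℤ₃
fromℕ 0                   = 0₃
fromℕ 1                   = 1₃
fromℕ 2                   = 2₃
fromℕ (suc (suc (suc n))) = fromℕ n

fromℕ-suc : ∀ n → fromℕ (suc n) ≡ suc₃ (fromℕ n)
fromℕ-suc 0                   = refl
fromℕ-suc 1                   = refl
fromℕ-suc 2                   = refl
fromℕ-suc (suc (suc (suc n))) = fromℕ-suc n

fromℕ-+ : ∀ m n → fromℕ (m ℕ.+ n) ≡ fromℕ m +₃ fromℕ n
fromℕ-+ zero    n = refl
fromℕ-+ (suc m) n = begin
  fromℕ (suc (m ℕ.+ n))     ≡⟨ fromℕ-suc (m ℕ.+ n) ⟩
  suc₃ (fromℕ (m ℕ.+ n))    ≡⟨ cong suc₃ (fromℕ-+ m n) ⟩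
  suc₃ (fromℕ m +₃ fromℕ n) ≡⟨ suc₃-+₃ (fromℕ m) (fromℕ n) ⟨
  suc₃ (fromℕ m) +₃ fromℕ n ≡⟨ cong (_+₃ fromℕ n) (fromℕ-suc m) ⟨
  fromℕ (suc m) +₃ fromℕ n  ∎

fromℕ-* : ∀ m n → fromℕ (m ℕ.* n) ≡ fromℕ m *₃ fromℕ n
fromℕ-* zero    n = refl
fromℕ-* (suc m) n = begin
  fromℕ (n ℕ.+ m ℕ.* n)          ≡⟨ fromℕ-+ n (m ℕ.* n) ⟩
  fromℕ n +₃ fromℕ (m ℕ.* n)     ≡⟨ cong (fromℕ n +₃_) (fromℕ-* m n) ⟩
  fromℕ n +₃ fromℕ m *₃ fromℕ n  ≡⟨ suc₃-*₃ (fromℕ m) (fromℕ n) ⟨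
  suc₃ (fromℕ m) *₃ fromℕ n      ≡⟨ cong (_*₃ fromℕ n) (fromℕ-suc m) ⟨
  fromℕ (suc m) *₃ fromℕ n       ∎

fromℕ≡0⇒3∣ : ∀ n → fromℕ n ≡ 0₃ → 3 ∣ n
fromℕ≡0⇒3∣ 0                   _ = 3 ∣0
fromℕ≡0⇒3∣ (suc (suc (suc n))) e with fromℕ≡0⇒3∣ n e
... | divides q n≡q*3 = divides (suc q) (cong (3 ℕ.+_) n≡q*3)

fromℤ : ℤ → ℤ₃
fromℤ (+ n)    = fromℕ n
fromℤ -[1+ n ] = -₃ fromℕ (suc n)

fromℤ≡0⇒3∣ : ∀ i → fromℤ i ≡ 0₃ → 3 ∣ ∣ i ∣
fromℤ≡0⇒3∣ (+ n)    e = fromℕ≡0⇒3∣ n e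
fromℤ≡0⇒3∣ -[1+ n ] e =
  fromℕ≡0⇒3∣ (suc n) (trans (sym (-₃-involutive _)) (cong -₃_ e))

fromℤ-⊖ : ∀ m n → fromℤ (m ⊖ n) ≡ fromℕ m -₃ fromℕ n
fromℤ-⊖ zero    zero    = refl
fromℤ-⊖ zero    (suc n) = refl
fromℤ-⊖ (suc m) zero    = sym (+₃-identityʳ (fromℕ (suc m)))
fromℤ-⊖ (suc m) (suc n) = begin
  fromℤ (suc m ⊖ suc n)                ≡⟨ cong fromℤ (ℤ.[1+m]⊖[1+n]≡m⊖n m n) ⟩
  fromℤ (m ⊖ n)                        ≡⟨ fromℤ-⊖ m n ⟩
  fromℕ m -₃ fromℕ n                   ≡⟨ suc₃-₃suc₃ (fromℕ m) (fromℕ n) ⟨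
  suc₃ (fromℕ m) -₃ suc₃ (fromℕ n)     ≡⟨ cong₂ _-₃_ (fromℕ-suc m) (fromℕ-suc n) ⟨
  fromℕ (suc m) -₃ fromℕ (suc n)       ∎

fromℤ-+ : ∀ i j → fromℤ (i ℤ.+ j) ≡ fromℤ i +₃ fromℤ j
fromℤ-+ (+ m)    (+ n)    = fromℕ-+ m n
fromℤ-+ (+ m)    -[1+ n ] = fromℤ-⊖ m (suc n)
fromℤ-+ -[1+ m ] (+ n)    = trans (fromℤ-⊖ n (suc m)) (+₃-comm (fromℕ n) _)
fromℤ-+ -[1+ m ] -[1+ n ] = begin
  -₃ fromℕ (suc (suc (m ℕ.+ n)))          ≡⟨ cong (λ k → -₃ fromℕ (suc k)) (ℕ.+-suc m n) ⟨
  -₃ fromℕ (suc m ℕ.+ suc n)              ≡⟨ cong -₃_ (fromℕ-+ (suc m) (suc n)) ⟩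
  -₃ (fromℕ (suc m) +₃ fromℕ (suc n))     ≡⟨ -₃‿distrib-+₃ (fromℕ (suc m)) (fromℕ (suc n)) ⟩
  -₃ fromℕ (suc m) +₃ -₃ fromℕ (suc n)    ∎

signed : Sign → ℤ₃ → ℤ₃
signed Sign.+ a = a
signed Sign.- a = -₃ a

fromℤ-◃ : ∀ s n → fromℤ (s ◃ n) ≡ signed s (fromℕ n)
fromℤ-◃ Sign.+ zero    = refl
fromℤ-◃ Sign.+ (suc n) = refl
fromℤ-◃ Sign.- zero    = refl
fromℤ-◃ Sign.- (suc n) = refl

fromℤ-signAbs : ∀ i → fromℤ i ≡ signed (sign i) (fromℕ ∣ i ∣)
fromℤ-signAbs (+ n)    = refl
fromℤ-signAbs -[1+ n ] = refl

signed-*₃ : ∀ s t a b → signed (s Sign.* t) (a *₃ b) ≡ signed s a *₃ signed t b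
signed-*₃ Sign.+ Sign.+ a b = refl
signed-*₃ Sign.+ Sign.- a b = -₃‿distribʳ-*₃ a b
signed-*₃ Sign.- Sign.+ a b = -₃‿distribˡ-*₃ a b
signed-*₃ Sign.- Sign.- a b = -₃*₃-₃ a b

fromℤ-* : ∀ i j → fromℤ (i ℤ.* j) ≡ fromℤ i *₃ fromℤ j
fromℤ-* i j = begin
  fromℤ (s ◃ ∣ i ∣ ℕ.* ∣ j ∣)                          ≡⟨ fromℤ-◃ s (∣ i ∣ ℕ.* ∣ j ∣) ⟩
  signed s (fromℕ (∣ i ∣ ℕ.* ∣ j ∣))                   ≡⟨ cong (signed s) (fromℕ-* ∣ i ∣ ∣ j ∣) ⟩
  signed s (fromℕ ∣ i ∣ *₃ fromℕ ∣ j ∣)                ≡⟨ signed-*₃ (sign i) (sign j) _ _ ⟩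
  signed (sign i) (fromℕ ∣ i ∣) *₃ signed (sign j) (fromℕ ∣ j ∣)
    ≡⟨ cong₂ _*₃_ (fromℤ-signAbs i) (fromℤ-signAbs j) ⟨
  fromℤ i *₃ fromℤ j                                    ∎
  where s = sign i Sign.* sign j

fromℤ-neg : ∀ i → fromℤ (ℤ.- i) ≡ -₃ fromℤ i
fromℤ-neg (+ zero)  = refl
fromℤ-neg (+ suc n) = refl
fromℤ-neg -[1+ n ]  = sym (-₃-involutive (fromℕ (suc n)))

infix 4 _≡ᵘ_mod3 _≡_mod3

-- v lies in the local ring ℤ₍₃₎ and reduces to r in its residue field ℤ₃.
record _≡ᵘ_mod3 (v : ℚᵘ) (r : ℤ₃) : Set where
  field
    denominator≢0 : fromℕ (ℚᵘ.↧ₙ v) ≢ 0₃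
    numerator≡    : fromℤ (ℚᵘ.↥ v) ≡ r *₃ fromℕ (ℚᵘ.↧ₙ v)

open _≡ᵘ_mod3

_≡_mod3 : ℚ → ℤ₃ → Set
p ≡ r mod3 = toℚᵘ p ≡ᵘ r mod3

fromℤ-≃ : ∀ {v w} → v ≃ w →
  fromℤ (ℚᵘ.↥ v) *₃ fromℕ (ℚᵘ.↧ₙ w) ≡ fromℤ (ℚᵘ.↥ w) *₃ fromℕ (ℚᵘ.↧ₙ v)
fromℤ-≃ {v} {w} (*≡* eq) = begin
  fromℤ (ℚᵘ.↥ v) *₃ fromℕ (ℚᵘ.↧ₙ w) ≡⟨ fromℤ-* (ℚᵘ.↥ v) (ℚᵘ.↧ w) ⟨
  fromℤ (ℚᵘ.↥ v ℤ.* ℚᵘ.↧ w)          ≡⟨ cong fromℤ eq ⟩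
  fromℤ (ℚᵘ.↥ w ℤ.* ℚᵘ.↧ v)          ≡⟨ fromℤ-* (ℚᵘ.↥ w) (ℚᵘ.↧ v) ⟩
  fromℤ (ℚᵘ.↥ w) *₃ fromℕ (ℚᵘ.↧ₙ v) ∎

coprime⇒¬∣both : ∀ {m} → m ≢ 1 → (p : ℚ) → ¬ (m ∣ ∣ ↥ p ∣ × m ∣ ↧ₙ p)
coprime⇒¬∣both m≢1 (mkℚ _ _ coprime) m∣both = ⊥-elim-irr (m≢1 (coprime m∣both))

residue-from-≃ : ∀ {v r} (p : ℚ) → v ≃ toℚᵘ p → v ≡ᵘ r mod3 → p ≡ r mod3
residue-from-≃ {v} {r} p@(mkℚ n _ _) v≃p v≡r = record
  { denominator≢0 = proj₁ cancelled
  ; numerator≡    = proj₂ cancelled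
  }
  where
  cancelled = cross-cancel r (fromℕ (ℚᵘ.↧ₙ v)) (fromℤ n) (fromℕ (↧ₙ p))
    (denominator≢0 v≡r)
    (λ (n≡0 , d≡0) → coprime⇒¬∣both (λ ()) p (fromℤ≡0⇒3∣ n n≡0 , fromℕ≡0⇒3∣ (↧ₙ p) d≡0))
    (trans (cong (_*₃ fromℕ (↧ₙ p)) (sym (numerator≡ v≡r))) (fromℤ-≃ v≃p))

denominator-product≢0 : ∀ {v w r s} → v ≡ᵘ r mod3 → w ≡ᵘ s mod3 →
  fromℕ (ℚᵘ.↧ₙ v ℕ.* ℚᵘ.↧ₙ w) ≢ 0₃
denominator-product≢0 {v} {w} v≡r w≡s bd≡0 =
  *₃-nonzero _ _ (denominator≢0 v≡r) (denominator≢0 w≡s)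
    (trans (sym (fromℕ-* (ℚᵘ.↧ₙ v) (ℚᵘ.↧ₙ w))) bd≡0)

residueᵘ-+ : ∀ {v w r s} → v ≡ᵘ r mod3 → w ≡ᵘ s mod3 → v ℚᵘ.+ w ≡ᵘ r +₃ s mod3
residueᵘ-+ {v@(mkℚᵘ m _)} {w@(mkℚᵘ n _)} {r} {s} v≡r w≡s = record
  { denominator≢0 = denominator-product≢0 v≡r w≡s
  ; numerator≡    = begin
      fromℤ (m ℤ.* ℚᵘ.↧ w ℤ.+ n ℤ.* ℚᵘ.↧ v)    ≡⟨ fromℤ-+ (m ℤ.* ℚᵘ.↧ w) (n ℤ.* ℚᵘ.↧ v) ⟩
      fromℤ (m ℤ.* ℚᵘ.↧ w) +₃ fromℤ (n ℤ.* ℚᵘ.↧ v)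
        ≡⟨ cong₂ _+₃_ (fromℤ-* m (ℚᵘ.↧ w)) (fromℤ-* n (ℚᵘ.↧ v)) ⟩
      fromℤ m *₃ d +₃ fromℤ n *₃ b
        ≡⟨ cong₂ (λ x y → x *₃ d +₃ y *₃ b) (numerator≡ v≡r) (numerator≡ w≡s) ⟩
      (r *₃ b) *₃ d +₃ (s *₃ d) *₃ b           ≡⟨ fraction-+₃ r b s d ⟩
      (r +₃ s) *₃ (b *₃ d)                     ≡⟨ cong ((r +₃ s) *₃_) (fromℕ-* (ℚᵘ.↧ₙ v) (ℚᵘ.↧ₙ w)) ⟨
      (r +₃ s) *₃ fromℕ (ℚᵘ.↧ₙ v ℕ.* ℚᵘ.↧ₙ w) ∎
  }
  where b = fromℕ (ℚᵘ.↧ₙ v); d = fromℕ (ℚᵘ.↧ₙ w)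

residueᵘ-* : ∀ {v w r s} → v ≡ᵘ r mod3 → w ≡ᵘ s mod3 → v ℚᵘ.* w ≡ᵘ r *₃ s mod3
residueᵘ-* {v@(mkℚᵘ m _)} {w@(mkℚᵘ n _)} {r} {s} v≡r w≡s = record
  { denominator≢0 = denominator-product≢0 v≡r w≡s
  ; numerator≡    = begin
      fromℤ (m ℤ.* n)                          ≡⟨ fromℤ-* m n ⟩
      fromℤ m *₃ fromℤ n                       ≡⟨ cong₂ _*₃_ (numerator≡ v≡r) (numerator≡ w≡s) ⟩
      (r *₃ b) *₃ (s *₃ d)                     ≡⟨ fraction-*₃ r b s d ⟩
      (r *₃ s) *₃ (b *₃ d)                     ≡⟨ cong ((r *₃ s) *₃_) (fromℕ-* (ℚᵘ.↧ₙ v) (ℚᵘ.↧ₙ w)) ⟨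
      (r *₃ s) *₃ fromℕ (ℚᵘ.↧ₙ v ℕ.* ℚᵘ.↧ₙ w) ∎
  }
  where b = fromℕ (ℚᵘ.↧ₙ v); d = fromℕ (ℚᵘ.↧ₙ w)

residueᵘ-neg : ∀ {v r} → v ≡ᵘ r mod3 → ℚᵘ.- v ≡ᵘ -₃ r mod3
residueᵘ-neg {mkℚᵘ m _} {r} v≡r = record
  { denominator≢0 = denominator≢0 v≡r
  ; numerator≡    = trans (fromℤ-neg m)
      (trans (cong -₃_ (numerator≡ v≡r)) (-₃‿distribˡ-*₃ r _))
  }

residue-+ : ∀ p q {r s} → p ≡ r mod3 → q ≡ s mod3 → p ℚ.+ q ≡ r +₃ s mod3
residue-+ p q p≡r q≡s =
  residue-from-≃ (p ℚ.+ q) (ℚᵘ.≃-sym (ℚ.toℚᵘ-homo-+ p q)) (residueᵘ-+ p≡r q≡s)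

residue-* : ∀ p q {r s} → p ≡ r mod3 → q ≡ s mod3 → p ℚ.* q ≡ r *₃ s mod3
residue-* p q p≡r q≡s =
  residue-from-≃ (p ℚ.* q) (ℚᵘ.≃-sym (ℚ.toℚᵘ-homo-* p q)) (residueᵘ-* p≡r q≡s)

residue-neg : ∀ p {r} → p ≡ r mod3 → ℚ.- p ≡ -₃ r mod3
residue-neg p p≡r =
  residue-from-≃ (ℚ.- p) (ℚᵘ.≃-sym (ℚ.toℚᵘ-homo‿- p)) (residueᵘ-neg p≡r)

residue-- : ∀ p q {r s} → p ≡ r mod3 → q ≡ s mod3 → p ℚ.- q ≡ r -₃ s mod3
residue-- p q p≡r q≡s = residue-+ p (ℚ.- q) p≡r (residue-neg q q≡s)

-- d itself need not be 3-integral: the coprimality of its numerator and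
-- denominator is what forces its denominator to be a unit mod 3.
residue-of-square : ∀ (d : ℚ) {r} → d * d ≡ r mod3 → ∃ λ s → r ≡ s *₃ s
residue-of-square d@(mkℚ n k _) {r} d²≡r = fromℤ n *₃ D , cross-square r e (fromℤ n) D
    (denominator≢0 d²≡r)
    (λ (n≡0 , D≡0) → coprime⇒¬∣both (λ ()) d (fromℤ≡0⇒3∣ n n≡0 , fromℕ≡0⇒3∣ (↧ₙ d) D≡0))
    (begin
      (r *₃ e) *₃ (D *₃ D)                     ≡⟨ cong₂ _*₃_ (numerator≡ d²≡r) (fromℕ-* (↧ₙ d) (↧ₙ d)) ⟨
      fromℤ (ℚᵘ.↥ E) *₃ fromℕ (↧ₙ d ℕ.* ↧ₙ d)  ≡⟨ fromℤ-≃ (ℚ.toℚᵘ-homo-* d d) ⟩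
      fromℤ (n ℤ.* n) *₃ e                     ≡⟨ cong (_*₃ e) (fromℤ-* n n) ⟩
      (fromℤ n *₃ fromℤ n) *₃ e                ∎)
  where
  E = toℚᵘ (d * d)
  e = fromℕ (ℚᵘ.↧ₙ E)
  D = fromℕ (↧ₙ d)

residue-/ : ∀ i n .{{_ : NonZero n}} → ¬ 3 ∣ n → i ℚ./ n ≡ fromℤ i *₃ fromℕ n mod3
residue-/ i (suc k) 3∤n =
  residue-from-≃ (i ℚ./ suc k) (ℚᵘ.≃-sym (ℚ.toℚᵘ-fromℚᵘ (mkℚᵘ i k))) record
  { denominator≢0 = n≢0
  ; numerator≡    = unit-self-inverse (fromℤ i) (fromℕ (suc k)) n≢0
  }
  where n≢0 = λ n≡0 → 3∤n (fromℕ≡0⇒3∣ (suc k) n≡0)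

split-power : ∀ {p} → 1 ℕ.< p → ∀ m .{{_ : NonZero m}} → p ∣ m →
  ∃₂ λ j s → ¬ p ∣ s × m ≡ p ^ suc j ℕ.* s
split-power {p} 1<p m = go m (<-wellFounded m)
  where
  go : ∀ m .{{_ : NonZero m}} → Acc ℕ._<_ m → p ∣ m → ∃₂ λ j s → ¬ p ∣ s × m ≡ p ^ suc j ℕ.* s
  go m _         (divides zero m≡0) = ⊥-elim (ℕ.≢-nonZero⁻¹ m m≡0)
  go m (acc rec) (divides q@(suc _) m≡q*p) with p ∣? q
  ... | no p∤q = 0 , q , p∤q , (begin
    m                 ≡⟨ m≡q*p ⟩
    q ℕ.* p           ≡⟨ ℕ.*-comm q p ⟩
    p ℕ.* q           ≡⟨ cong (ℕ._* q) (ℕ.*-identityʳ p) ⟨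
    p ^ 1 ℕ.* q       ∎)
  ... | yes p∣q with go q (rec (subst (q ℕ.<_) (sym m≡q*p) (ℕ.m<m*n q p 1<p))) p∣q
  ...   | j , s , p∤s , q≡ = suc j , s , p∤s , (begin
    m                         ≡⟨ m≡q*p ⟩
    q ℕ.* p                   ≡⟨ cong (ℕ._* p) q≡ ⟩
    p ^ suc j ℕ.* s ℕ.* p     ≡⟨ ℕ.*-comm (p ^ suc j ℕ.* s) p ⟩
    p ℕ.* (p ^ suc j ℕ.* s)   ≡⟨ ℕ.*-assoc p (p ^ suc j) s ⟨
    p ^ suc (suc j) ℕ.* s     ∎)

/-congʳ : ∀ i {m n} .{{_ : NonZero m}} .{{_ : NonZero n}} → m ≡ n → i ℚ./ m ≡ i ℚ./ n
/-congʳ i refl = refl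

denominator-divisible⇒ValNeg : ∀ {p} .{{_ : NonZero p}} → 1 ℕ.< p → (q : ℚ) → p ∣ ↧ₙ q → ValNeg p q
denominator-divisible⇒ValNeg {p} 1<p q p∣↧q with split-power 1<p (↧ₙ q) p∣↧q
... | j , s , p∤s , ↧q≡ = -[1+ j ] , ℤ.-<+ , ↥ q , s , s≢0 , p∤↥q , p∤s ,
      trans (sym (ℚ.↥p/↧p≡p q)) (/-congʳ (↥ q) {{_}} {{nz}} ↧q≡)
  where
  s≢0 : NonZero s
  s≢0 = ℕ.≢-nonZero λ { refl → p∤s (p ∣0) }
  nz : NonZero (p ^ suc j ℕ.* s)
  nz = ℕ.m*n≢0 (p ^ suc j) s {{ℕ.m^n≢0 p (suc j)}} {{s≢0}}
  p∤↥q : ¬ p ∣ ∣ ↥ q ∣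
  p∤↥q p∣↥q = coprime⇒¬∣both (λ { refl → ℕ.<-irrefl refl 1<p }) q (p∣↥q , p∣↧q)

residue-or-ValNeg : (p : ℚ) → ValNeg 3 p ⊎ ∃ (p ≡_mod3)
residue-or-ValNeg p@(mkℚ n _ _) with fromℕ (↧ₙ p) ≟₃ 0₃
... | yes D≡0 =
  inj₁ (denominator-divisible⇒ValNeg (ℕ.s≤s (ℕ.s≤s ℕ.z≤n)) p (fromℕ≡0⇒3∣ (↧ₙ p) D≡0))
... | no  D≢0 = inj₂ (fromℤ n *₃ fromℕ (↧ₙ p) , record
  { denominator≢0 = D≢0
  ; numerator≡    = unit-self-inverse (fromℤ n) (fromℕ (↧ₙ p)) D≢0
  })

unit-residue : ∀ {a} → HasVal 3 a (+ 0) → ∃ λ A → A ≢ 0₃ × a ≡ A mod3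
unit-residue (r , s , s≢0 , 3∤r , 3∤s , a≡r/s) =
  fromℤ r *₃ fromℕ s ,
  *₃-nonzero (fromℤ r) (fromℕ s) (3∤r ∘ fromℤ≡0⇒3∣ r) (3∤s ∘ fromℕ≡0⇒3∣ s) ,
  subst (_≡ _ mod3) (sym (trans a≡r/s (cong (λ i → (i ℚ./ s) {{s≢0}}) (ℤ.*-identityˡ r))))
    (residue-/ r s {{s≢0}} 3∤s)

RatDist⇒coordinate-congruent : ∀ {x₁ y₁ x₂ y₂ X₁ Y₁ X₂ Y₂} → RatDist x₁ y₁ x₂ y₂ →
  x₁ ≡ X₁ mod3 → y₁ ≡ Y₁ mod3 → x₂ ≡ X₂ mod3 → y₂ ≡ Y₂ mod3 → X₁ ≡ X₂ ⊎ Y₁ ≡ Y₂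
RatDist⇒coordinate-congruent {x₁} {y₁} {x₂} {y₂} {X₁} {Y₁} {X₂} {Y₂} (d , _ , d²≡) x₁≡ y₁≡ x₂≡ y₂≡
  with X₁ ≟₃ X₂ | Y₁ ≟₃ Y₂
... | yes X₁≡X₂ | _         = inj₁ X₁≡X₂
... | no _      | yes Y₁≡Y₂ = inj₂ Y₁≡Y₂
... | no X₁≢X₂  | no Y₁≢Y₂  = ⊥-elim (2-nonsquare (proj₁ root)
  (trans (sym (proj₂ root)) (nonzero-squares-sum≡2 X₁ X₂ Y₁ Y₂ X₁≢X₂ Y₁≢Y₂)))
  where
  Δx = residue-- x₁ x₂ x₁≡ x₂≡
  Δy = residue-- y₁ y₂ y₁≡ y₂≡
  root = residue-of-square d (subst (_≡ _ mod3) (sym d²≡)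
           (residue-+ _ _ (residue-* _ _ Δx Δx) (residue-* _ _ Δy Δy)))

corners-of-rectangle : ∀ {A : Set} {x₀ x₁ y₀ y₁ x y : A} → x₀ ≢ x₁ → y₀ ≢ y₁ →
  x ≡ x₀ ⊎ y ≡ y₀ → x ≡ x₀ ⊎ y ≡ y₁ → x ≡ x₁ ⊎ y ≡ y₀ → x ≡ x₁ ⊎ y ≡ y₁ → ⊥
corners-of-rectangle {x₀ = x₀} {x₁} x₀≢x₁ y₀≢y₁ c₀₀ c₀₁ c₁₀ c₁₁ =
  y₀≢y₁ (trans (sym (same-row c₀₀ c₁₀)) (same-row c₀₁ c₁₁))
  where
  same-row : ∀ {x y c} → x ≡ x₀ ⊎ y ≡ c → x ≡ x₁ ⊎ y ≡ c → y ≡ c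
  same-row (inj₂ y≡c)  _           = y≡c
  same-row (inj₁ _)    (inj₂ y≡c)  = y≡c
  same-row (inj₁ x≡x₀) (inj₁ x≡x₁) = ⊥-elim (x₀≢x₁ (trans (sym x≡x₀) x≡x₁))

proposition2p1 : (a x z : ℚ) → HasVal 3 a (+ 0) →
    RatDist x (z * ½) 0ℚ ½ → RatDist x (z * ½) 0ℚ -½ →
    RatDist x (z * ½) a ½ → RatDist x (z * ½) a -½ →
    ValNeg 3 x ⊎ ValNeg 3 z
proposition2p1 a x z a-unit d₀₊ d₀₋ dₐ₊ dₐ₋ with residue-or-ValNeg x | residue-or-ValNeg z
... | inj₁ x<0       | _              = inj₁ x<0
... | inj₂ _         | inj₁ z<0       = inj₂ z<0
... | inj₂ (X , x≡X) | inj₂ (Z , z≡Z) with unit-residue a-unit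
...   | A , A≢0 , a≡A = ⊥-elim (corners-of-rectangle (≢-sym A≢0) (λ ())
          (meets d₀₊ 0≡0 ½≡2) (meets d₀₋ 0≡0 -½≡1) (meets dₐ₊ a≡A ½≡2) (meets dₐ₋ a≡A -½≡1))
  where
  0≡0 : 0ℚ ≡ 0₃ mod3
  0≡0 = record { denominator≢0 = λ () ; numerator≡ = refl }
  ½≡2 : ½ ≡ 2₃ mod3
  ½≡2 = record { denominator≢0 = λ () ; numerator≡ = refl }
  -½≡1 : -½ ≡ 1₃ mod3
  -½≡1 = record { denominator≢0 = λ () ; numerator≡ = refl }
  meets : ∀ {x₂ y₂ X₂ Y₂} → RatDist x (z * ½) x₂ y₂ → x₂ ≡ X₂ mod3 → y₂ ≡ Y₂ mod3 →
    X ≡ X₂ ⊎ Z *₃ 2₃ ≡ Y₂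
  meets dist = RatDist⇒coordinate-congruent dist x≡X (residue-* z ½ z≡Z ½≡2)
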